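{- Let $\ell$ be a line of $\mathrm{PG}_q(\mathbb{F}_{q^t})$ and let $d\ge0$ be an integer, written uniquely as $d=\sum_{i\ge0}a_iq^i$ with $0\le a_i<q$; let $d_q=\sum_{i\ge0}a_i$ and suppose $q\ge d_q$. Suppose $\ell^d$ contains a set of $d_q+1$ points in general position, and let $\mathcal{B}$ be the $d_q$-dimensional subspace of $\mathrm{PG}_q(\mathbb{F}_{q^t})$ they span. Then $\ell^d$ is a normal rational curve of order $d_q$ in $\mathcal{B}$.
   Context: $\mathrm{PG}_q(\mathbb{F}_{q^t})\cong\mathrm{PG}(t-1,q)$ has as points $\langle x\rangle_q=\mathbb{F}_qx$, $x\in\mathbb{F}_{q^t}^*$, and $\ell^d=\{\langle x^d\rangle_q:\langle x\rangle_q\in\ell\}$. A normal rational curve of order $n$ in an $n$-dimensional subspace $\mathcal{B}\cong\mathrm{PG}(n,q)$ is the image under a projectivity $\mathrm{PG}(n,q)\to\mathcal{B}$ of $\{\langle(1,\lambda,\ldots,\lambda^n)\rangle:\lambda\in\mathbb{F}_q\}\cup\{\langle(0,\ldots,0,1)\rangle\}$. -}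

module Defs where

open import Data.Nat as ℕ using (ℕ; zero; suc)
open import Data.Fin using (Fin; zero; suc; fromℕ; toℕ)
open import Data.Bool using (Bool; T)
open import Data.List using (List; []; _∷_)
open import Data.Product using (Σ; _×_; _,_)
open import Data.Sum using (_⊎_)
open import Relation.Binary.PropositionalEquality using (_≡_; _≢_)
open import Algebra.Core using (Op₁; Op₂)
open import Algebra.Structures using (IsCommutativeRing)
open import Function.Bundles using (_↔_; _⇔_)

fromDigits : ℕ → List ℕ → ℕ
fromDigits q [] = 0
fromDigits q (a ∷ as) = a ℕ.+ q ℕ.* fromDigits q as

-- A finite field K of order q^t (propositional equality), together with
-- its subfield F_q of order q (given by a Boolean membership test).
record FieldExt (q t : ℕ) : Set₁ where
  infixl 6 _+_
  infixl 7 _*_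
  field
    K          : Set
    _+_ _*_    : Op₂ K
    -_         : Op₁ K
    0# 1#      : K
    isCommRing : IsCommutativeRing _≡_ _+_ _*_ -_ 0# 1#
    0≢1        : 0# ≢ 1#
    inv        : K → K
    inv-r      : ∀ x → x ≢ 0# → x * inv x ≡ 1#
    enumK      : K ↔ Fin (q ℕ.^ t)
    isFq       : K → Bool
    Fq-0       : T (isFq 0#)
    Fq-1       : T (isFq 1#)
    Fq-+       : ∀ x y → T (isFq x) → T (isFq y) → T (isFq (x + y))
    Fq-*       : ∀ x y → T (isFq x) → T (isFq y) → T (isFq (x * y))
    Fq-neg     : ∀ x → T (isFq x) → T (isFq (- x))
    Fq-inv     : ∀ x → x ≢ 0# → T (isFq x) → T (isFq (inv x))
    enumFq     : Σ K (λ x → T (isFq x)) ↔ Fin q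

-- Projective geometry PG_q(K): points are ⟨x⟩_q = F_q x for x ≠ 0,
-- represented by nonzero vectors; point sets are predicates on K that are
-- compared pointwise (all sets below are invariant under F_q^*-scaling).
module Geometry {q t : ℕ} (F : FieldExt q t) where
  open FieldExt F

  InFq : K → Set
  InFq x = T (isFq x)

  infixr 8 _^_
  _^_ : K → ℕ → K
  x ^ zero = 1#
  x ^ suc n = x * (x ^ n)

  ∑ : ∀ {n} → (Fin n → K) → K
  ∑ {zero} f = 0#
  ∑ {suc n} f = f zero + ∑ (λ i → f (suc i))

  comb : ∀ {n} → (Fin n → K) → (Fin n → K) → K
  comb c v = ∑ (λ i → c i * v i)

  InSpan : ∀ {n} → (Fin n → K) → K → Set
  InSpan {n} v x = Σ (Fin n → K) λ c → (∀ i → InFq (c i)) × x ≡ comb c v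

  Indep : ∀ {n} → (Fin n → K) → Set
  Indep {n} v = (c : Fin n → K) → (∀ i → InFq (c i)) → comb c v ≡ 0# → ∀ i → c i ≡ 0#

  SamePoint : K → K → Set
  SamePoint x y = Σ K λ μ → InFq μ × μ ≢ 0# × x ≡ μ * y

  pair : K → K → Fin 2 → K
  pair u v zero = u
  pair u v (suc _) = v

  OnLine : K → K → K → Set
  OnLine u v x = x ≢ 0# × InSpan (pair u v) x

  OnLinePow : ℕ → K → K → K → Set
  OnLinePow d u v y = y ≢ 0# × Σ K λ x → OnLine u v x × SamePoint y (x ^ d)

  -- y represents a point of the image of the standard normal rational curve
  -- {⟨(1,λ,…,λⁿ)⟩ : λ ∈ F_q} ∪ {⟨(0,…,0,1)⟩} under the projectivity
  -- PG(n,q) → ⟨b₀,…,bₙ⟩ induced by (c₀,…,cₙ) ↦ Σ cᵢ bᵢ.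
  NRCPoint : (n : ℕ) → (Fin (suc n) → K) → K → Set
  NRCPoint n b y =
    y ≢ 0# ×
    ((Σ K λ l → InFq l × SamePoint y (∑ (λ i → (l ^ toℕ i) * b i)))
     ⊎ SamePoint y (b (fromℕ n)))

  -- The point set S is a normal rational curve of order n in the subspace B
  -- (B given as a predicate on vectors): there is a projectivity
  -- PG(n,q) → B, i.e. an F_q-basis b₀,…,bₙ of B, mapping the standard NRC onto S.
  IsNRC : (n : ℕ) → (K → Set) → (K → Set) → Set
  IsNRC n B S =
    Σ (Fin (suc n) → K) λ b →
      Indep b × (∀ x → InSpan b x ⇔ B x) × (∀ y → S y ⇔ NRCPoint n b y)

module Submission where

open import Defs
open import Data.Nat using (ℕ; suc; _≤_; _<_)
open import Data.Fin using (Fin)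
open import Data.List using (List)
open import Data.Nat.ListAction using (sum)
open import Data.List.Relation.Unary.All using (All)
open import Relation.Binary.PropositionalEquality using (_≡_)

open import Data.Nat as ℕ using (zero; s≤s; z≤n; _∸_)
import Data.Nat.Properties as ℕP
open import Data.Nat.Combinatorics using (nCn≡1) renaming (_C_ to _choose_)
open import Data.Fin as Fin using (zero; suc; toℕ; fromℕ; inject₁; funToFin; finToFun)
import Data.Fin.Properties as FinP
import Data.Fin.Permutation as Perm
open import Data.Bool.Properties using (T-irrelevant)
open import Data.Empty using (⊥-elim)
open import Data.Product using (Σ; _×_; _,_; proj₁; proj₂)
open import Data.Sum using (_⊎_; inj₁; inj₂; [_,_])
open import Data.List using ([]; _∷_)
open import Data.Maybe using (nothing)
open import Relation.Nullary using (Dec; yes; no)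
open import Relation.Nullary.Decidable using (map′)
open import Relation.Binary.PropositionalEquality
  using (refl; sym; trans; cong; cong₂; subst; _≢_; module ≡-Reasoning)
open import Function.Bundles using (Inverse; Injection; mk⇔)
open import Function.Properties.Inverse using (↔⇒↣)
open import Algebra.Bundles using (CommutativeRing)
import Algebra.Solver.Ring.NaturalCoefficients
import Algebra.Properties.Ring
import Algebra.Properties.CommutativeMonoid.Sum
import Algebra.Properties.Monoid.Sum
import Algebra.Properties.CommutativeSemiring.Binomial
import Algebra.Properties.Semiring.Exp
import Algebra.Properties.Semiring.Mult

-- A point of ℓ is ⟨αu + βv⟩ with α, β ∈ F_q, and d = Σ aᵢ qⁱ.
-- The map x ↦ x^q is additive (Frobenius) and fixes F_q (Fermat), so
--   (αu + βv)^d = Πᵢ (α u^(qⁱ) + β v^(qⁱ))^(aᵢ) = Σ_{k ≤ n} α^(n-k) β^k w_k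
-- for vectors w₀,…,w_n ∈ K that do not depend on the point, n = d_q.
-- Dehomogenising (λ = β/α, or α = 0) shows that ℓ^d is exactly the image of
-- the standard normal rational curve of PG(n,q) under (c_k) ↦ Σ c_k w_k.
-- Finally the n+1 given independent points of ℓ^d lie in ⟨w₀,…,w_n⟩, and
-- n+1 independent vectors in the span of n+1 vectors force those vectors to
-- be a basis of the same subspace B (a counting argument over F_q).

module _ {q t : ℕ} (F : FieldExt q t) where
  open FieldExt F
  open Geometry F
  open ≡-Reasoning

  K-ring : CommutativeRing _ _
  K-ring = record { isCommutativeRing = isCommRing }

  open CommutativeRing K-ring
    using ( _-_; +-comm; +-assoc; *-comm; *-assoc; zeroˡ; zeroʳ; distribʳ
          ; +-identityˡ; +-identityʳ; *-identityˡ; *-identityʳ; -‿inverseʳ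
          ; commutativeSemiring; semiring; +-monoid; *-commutativeMonoid )
  open Algebra.Solver.Ring.NaturalCoefficients commutativeSemiring (λ _ _ → nothing)
  module RP = Algebra.Properties.Ring (CommutativeRing.ring K-ring)

  _≟_ : (x y : K) → Dec (x ≡ y)
  x ≟ y = map′ (Injection.injective (↔⇒↣ enumK)) (cong (Inverse.to enumK))
               (Inverse.to enumK x Fin.≟ Inverse.to enumK y)

  1≢0 : 1# ≢ 0#
  1≢0 eq = 0≢1 (sym eq)

  inv-*-cancel : ∀ {a} → a ≢ 0# → ∀ x → inv a * (a * x) ≡ x
  inv-*-cancel {a} a≢0 x = begin
    inv a * (a * x) ≡⟨ sym (*-assoc (inv a) a x) ⟩
    inv a * a * x   ≡⟨ cong (_* x) (trans (*-comm (inv a) a) (inv-r a a≢0)) ⟩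
    1# * x          ≡⟨ *-identityˡ x ⟩
    x               ∎

  *-inv-cancel : ∀ {a} → a ≢ 0# → ∀ x → a * (inv a * x) ≡ x
  *-inv-cancel {a} a≢0 x = begin
    a * (inv a * x) ≡⟨ sym (*-assoc a (inv a) x) ⟩
    a * inv a * x   ≡⟨ cong (_* x) (inv-r a a≢0) ⟩
    1# * x          ≡⟨ *-identityˡ x ⟩
    x               ∎

  *-cancelˡ : ∀ {a x y} → a ≢ 0# → a * x ≡ a * y → x ≡ y
  *-cancelˡ {a} {x} {y} a≢0 eq = begin
    x               ≡⟨ sym (inv-*-cancel a≢0 x) ⟩
    inv a * (a * x) ≡⟨ cong (inv a *_) eq ⟩
    inv a * (a * y) ≡⟨ inv-*-cancel a≢0 y ⟩
    y               ∎

  *-nonzero : ∀ {x y} → x ≢ 0# → y ≢ 0# → x * y ≢ 0#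
  *-nonzero {x} x≢0 y≢0 xy≡0 = y≢0 (*-cancelˡ x≢0 (trans xy≡0 (sym (zeroʳ x))))

  -- If s ≠ a, then s x = a x forces x = 0 (cancel the nonzero s - a).
  *-cancel-distinct : ∀ {s a x} → s ≢ a → s * x ≡ a * x → x ≡ 0#
  *-cancel-distinct {s} {a} {x} s≢a eq = *-cancelˡ s-a≢0 (begin
    (s - a) * x   ≡⟨ RP.[y-z]x≈yx-zx x s a ⟩
    s * x - a * x ≡⟨ cong (_- a * x) eq ⟩
    a * x - a * x ≡⟨ -‿inverseʳ (a * x) ⟩
    0#            ≡⟨ sym (zeroʳ (s - a)) ⟩
    (s - a) * 0#  ∎)
    where
    s-a≢0 : s - a ≢ 0#
    s-a≢0 eq₀ = s≢a (RP.x∙y⁻¹≈ε⇒x≈y s a eq₀)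

  ^-+ : ∀ x m n → x ^ (m ℕ.+ n) ≡ x ^ m * x ^ n
  ^-+ x zero n = sym (*-identityˡ _)
  ^-+ x (suc m) n = trans (cong (x *_) (^-+ x m n)) (sym (*-assoc x _ _))

  ^-* : ∀ x m n → x ^ (m ℕ.* n) ≡ (x ^ m) ^ n
  ^-* x m zero = cong (x ^_) (ℕP.*-zeroʳ m)
  ^-* x m (suc n) = begin
    x ^ (m ℕ.* suc n)       ≡⟨ cong (x ^_) (ℕP.*-suc m n) ⟩
    x ^ (m ℕ.+ m ℕ.* n)     ≡⟨ ^-+ x m (m ℕ.* n) ⟩
    x ^ m * x ^ (m ℕ.* n)   ≡⟨ cong (x ^ m *_) (^-* x m n) ⟩
    x ^ m * (x ^ m) ^ n     ∎

  *-^ : ∀ x y n → (x * y) ^ n ≡ x ^ n * y ^ n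
  *-^ x y zero = sym (*-identityˡ 1#)
  *-^ x y (suc n) = trans (cong ((x * y) *_) (*-^ x y n))
    (solve 4 (λ x y a b → x :* y :* (a :* b) := x :* a :* (y :* b)) refl x y (x ^ n) (y ^ n))

  1^ : ∀ n → 1# ^ n ≡ 1#
  1^ zero = refl
  1^ (suc n) = trans (*-identityˡ _) (1^ n)

  ^-nonzero : ∀ {x} n → x ≢ 0# → x ^ n ≢ 0#
  ^-nonzero zero _ = 1≢0
  ^-nonzero (suc n) x≢0 = *-nonzero x≢0 (^-nonzero n x≢0)

  ^-Fq : ∀ {x} n → InFq x → InFq (x ^ n)
  ^-Fq zero _ = Fq-1
  ^-Fq (suc n) x∈ = Fq-* _ _ x∈ (^-Fq n x∈)

  ∑-cong : ∀ {n} {f g : Fin n → K} → (∀ i → f i ≡ g i) → ∑ f ≡ ∑ g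
  ∑-cong {zero} _ = refl
  ∑-cong {suc n} f≗g = cong₂ _+_ (f≗g zero) (∑-cong (λ i → f≗g (suc i)))

  ∑-zero : ∀ n → ∑ {n} (λ _ → 0#) ≡ 0#
  ∑-zero zero = refl
  ∑-zero (suc n) = trans (+-identityˡ _) (∑-zero n)

  ∑-+ : ∀ {n} (f g : Fin n → K) → ∑ (λ i → f i + g i) ≡ ∑ f + ∑ g
  ∑-+ {zero} f g = sym (+-identityʳ 0#)
  ∑-+ {suc n} f g = trans (cong (f zero + g zero +_) (∑-+ (λ i → f (suc i)) (λ i → g (suc i))))
    (solve 4 (λ a b c d → a :+ b :+ (c :+ d) := a :+ c :+ (b :+ d)) refl _ _ _ _)

  ∑-*ˡ : ∀ {n} a (f : Fin n → K) → a * ∑ f ≡ ∑ (λ i → a * f i)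
  ∑-*ˡ {zero} a f = zeroʳ a
  ∑-*ˡ {suc n} a f = trans (CommutativeRing.distribˡ K-ring a _ _)
    (cong (a * f zero +_) (∑-*ˡ a (λ i → f (suc i))))

  ∑-neg : ∀ {n} (f : Fin n → K) → ∑ (λ i → - f i) ≡ - ∑ f
  ∑-neg {zero} f = sym RP.-0#≈0#
  ∑-neg {suc n} f = trans (cong (- f zero +_) (∑-neg (λ i → f (suc i)))) (RP.-‿+-comm _ _)

  ∑-swap : ∀ {m n} (f : Fin m → Fin n → K) →
           ∑ (λ i → ∑ (λ j → f i j)) ≡ ∑ (λ j → ∑ (λ i → f i j))
  ∑-swap {zero} {n} f = sym (∑-zero n)
  ∑-swap {suc m} f = trans (cong (∑ (f zero) +_) (∑-swap (λ i → f (suc i))))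
    (sym (∑-+ (f zero) (λ j → ∑ (λ i → f (suc i) j))))

  ∑-init-last : ∀ {n} (f : Fin (suc n) → K) → ∑ f ≡ ∑ (λ k → f (inject₁ k)) + f (fromℕ n)
  ∑-init-last {zero} f = trans (+-identityʳ _) (sym (+-identityˡ _))
  ∑-init-last {suc n} f = trans (cong (f zero +_) (∑-init-last (λ i → f (suc i)))) (sym (+-assoc _ _ _))

  ∑-ends : ∀ {n} (f : Fin (suc (suc n)) → K) →
           ∑ f ≡ f zero + ∑ (λ k → f (suc (inject₁ k))) + f (fromℕ (suc n))
  ∑-ends f = trans (cong (f zero +_) (∑-init-last (λ i → f (suc i)))) (sym (+-assoc _ _ _))

  FqValued : ∀ {n} → (Fin n → K) → Set
  FqValued c = ∀ i → InFq (c i)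

  ∑-Fq : ∀ {n} (f : Fin n → K) → FqValued f → InFq (∑ f)
  ∑-Fq {zero} f _ = Fq-0
  ∑-Fq {suc n} f f∈ = Fq-+ _ _ (f∈ zero) (∑-Fq (λ i → f (suc i)) (λ i → f∈ (suc i)))

  comb-cong : ∀ {n} {c c' : Fin n → K} (v : Fin n → K) → (∀ i → c i ≡ c' i) → comb c v ≡ comb c' v
  comb-cong v c≗c' = ∑-cong (λ i → cong (_* v i) (c≗c' i))

  comb-*ˡ : ∀ {n} μ (c v : Fin n → K) → μ * comb c v ≡ comb (λ k → μ * c k) v
  comb-*ˡ μ c v = trans (∑-*ˡ μ (λ k → c k * v k)) (∑-cong (λ k → sym (*-assoc μ (c k) (v k))))

  comb-sub : ∀ {n} (c c' v : Fin n → K) → comb c v - comb c' v ≡ comb (λ i → c i - c' i) v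
  comb-sub c c' v = begin
    comb c v - comb c' v                 ≡⟨ cong (comb c v +_) (sym (∑-neg (λ i → c' i * v i))) ⟩
    comb c v + ∑ (λ i → - (c' i * v i))  ≡⟨ sym (∑-+ (λ i → c i * v i) (λ i → - (c' i * v i))) ⟩
    ∑ (λ i → c i * v i - c' i * v i)     ≡⟨ ∑-cong (λ i → sym (RP.[y-z]x≈yx-zx (v i) (c i) (c' i))) ⟩
    comb (λ i → c i - c' i) v            ∎

  indep-coefficients : ∀ {n} {v c c' : Fin n → K} → Indep v → FqValued c → FqValued c' →
                       comb c v ≡ comb c' v → ∀ i → c i ≡ c' i
  indep-coefficients {v = v} {c} {c'} v-indep c∈ c'∈ eq i = RP.x∙y⁻¹≈ε⇒x≈y (c i) (c' i)
    (v-indep (λ i → c i - c' i) (λ i → Fq-+ _ _ (c∈ i) (Fq-neg _ (c'∈ i)))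
      (trans (sym (comb-sub c c' v)) (trans (cong (_- comb c' v) eq) (-‿inverseʳ _))) i)

  elt : Fin q → K
  elt i = proj₁ (Inverse.from enumFq i)

  elt-Fq : ∀ i → InFq (elt i)
  elt-Fq i = proj₂ (Inverse.from enumFq i)

  index : (a : K) → InFq a → Fin q
  index a a∈ = Inverse.to enumFq (a , a∈)

  elt-index : ∀ a a∈ → elt (index a a∈) ≡ a
  elt-index a a∈ = cong proj₁ (Inverse.strictlyInverseʳ enumFq (a , a∈))

  index-cong : ∀ {a a'} a∈ a'∈ → a ≡ a' → index a a∈ ≡ index a' a'∈
  index-cong a∈ a'∈ refl = cong (index _) (T-irrelevant a∈ a'∈)

  index-elt : ∀ i a∈ → index (elt i) a∈ ≡ i
  index-elt i a∈ = trans (index-cong a∈ (elt-Fq i) refl) (Inverse.strictlyInverseˡ enumFq i)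

  elt-injective : ∀ {i j} → elt i ≡ elt j → i ≡ j
  elt-injective {i} {j} eq = begin
    i                    ≡⟨ sym (index-elt i (elt-Fq i)) ⟩
    index (elt i) _      ≡⟨ index-cong (elt-Fq i) (elt-Fq j) eq ⟩
    index (elt j) _      ≡⟨ index-elt j (elt-Fq j) ⟩
    j                    ∎

  -- F_q contains 0, so q ≥ 1.
  1≤q : 1 ≤ q
  1≤q = nonempty (index 0# Fq-0)
    where
    nonempty : ∀ {n} → Fin n → 1 ≤ n
    nonempty zero = s≤s z≤n
    nonempty (suc _) = s≤s z≤n

  module ΠK = Algebra.Properties.CommutativeMonoid.Sum *-commutativeMonoid

  Π : ∀ {n} → (Fin n → K) → K
  Π = ΠK.sum

  Π-nonzero : ∀ {n} (f : Fin n → K) → (∀ i → f i ≢ 0#) → Π f ≢ 0#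
  Π-nonzero {zero} f _ = 1≢0
  Π-nonzero {suc n} f f≢0 = *-nonzero (f≢0 zero) (Π-nonzero (λ i → f (suc i)) (λ i → f≢0 (suc i)))

  Π-all-but-one : ∀ {n} (f : Fin n → K) x z → f z ≡ 1# → (∀ i → i ≢ z → f i ≡ x) → x * Π f ≡ x ^ n
  Π-all-but-one {suc n} f x zero fz≡1 f≡x = cong (x *_) (begin
    f zero * Π (λ i → f (suc i)) ≡⟨ cong (_* Π (λ i → f (suc i))) fz≡1 ⟩
    1# * Π (λ i → f (suc i))     ≡⟨ *-identityˡ _ ⟩
    Π (λ i → f (suc i))          ≡⟨ all-x (λ i → f (suc i)) (λ i → f≡x (suc i) (λ ())) ⟩
    x ^ n                        ∎)
    where
    all-x : ∀ {m} (g : Fin m → K) → (∀ i → g i ≡ x) → Π g ≡ x ^ m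
    all-x {zero} g _ = refl
    all-x {suc m} g g≡x = cong₂ _*_ (g≡x zero) (all-x (λ i → g (suc i)) (λ i → g≡x (suc i)))
  Π-all-but-one {suc n} f x (suc z) fz≡1 f≡x = begin
    x * (f zero * Π (λ i → f (suc i))) ≡⟨ cong (λ a → x * (a * Π (λ i → f (suc i)))) (f≡x zero (λ ())) ⟩
    x * (x * Π (λ i → f (suc i)))      ≡⟨ cong (x *_) (Π-all-but-one (λ i → f (suc i)) x z fz≡1
                                            (λ i i≢z → f≡x (suc i) (λ eq → i≢z (FinP.suc-injective eq)))) ⟩
    x * x ^ n                          ∎

  module Scaling (x : K) (x∈ : InFq x) (x≢0 : x ≢ 0#) where
    σ τ : Fin q → Fin q
    σ i = index (x * elt i) (Fq-* _ _ x∈ (elt-Fq i))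
    τ i = index (inv x * elt i) (Fq-* _ _ (Fq-inv x x≢0 x∈) (elt-Fq i))

    elt-σ : ∀ i → elt (σ i) ≡ x * elt i
    elt-σ i = elt-index _ _

    σ-permutation : Perm.Permutation q q
    σ-permutation = Perm.permutation σ τ
      (λ i → trans (index-cong _ (elt-Fq i) (trans (cong (x *_) (elt-index _ _)) (*-inv-cancel x≢0 (elt i))))
                   (index-elt i (elt-Fq i)))
      (λ i → trans (index-cong _ (elt-Fq i) (trans (cong (inv x *_) (elt-index _ _)) (inv-*-cancel x≢0 (elt i))))
                   (index-elt i (elt-Fq i)))

  ν : K → K
  ν a with a ≟ 0#
  ... | yes _ = 1#
  ... | no _ = a

  ν-factor : K → K → K
  ν-factor x a with a ≟ 0#
  ... | yes _ = 1#
  ... | no _ = x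

  ν-nonzero : ∀ a → ν a ≢ 0#
  ν-nonzero a with a ≟ 0#
  ... | yes _ = 1≢0
  ... | no a≢0 = a≢0

  ν-* : ∀ x a → x ≢ 0# → ν (x * a) ≡ ν-factor x a * ν a
  ν-* x a x≢0 with a ≟ 0# | (x * a) ≟ 0#
  ... | yes _   | yes _    = sym (*-identityˡ 1#)
  ... | yes a≡0 | no xa≢0  = ⊥-elim (xa≢0 (trans (cong (x *_) a≡0) (zeroʳ x)))
  ... | no a≢0  | yes xa≡0 = ⊥-elim (*-nonzero x≢0 a≢0 xa≡0)
  ... | no _    | no _     = refl

  -- For x ≠ 0, permuting the
  -- factors of Π ν(a) (a ∈ F_q) by a ↦ x a gives Π ν-factor x a = 1,
  -- and x · Π ν-factor x a = x^q since exactly one factor (at a = 0) is 1.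
  fermat : ∀ x → InFq x → x ^ q ≡ x
  fermat x x∈ with x ≟ 0#
  ... | yes refl = zero-power 1≤q
    where
    zero-power : ∀ {n} → 1 ≤ n → 0# ^ n ≡ 0#
    zero-power (s≤s _) = zeroˡ _
  ... | no x≢0 = begin
      x ^ q        ≡⟨ sym (Π-all-but-one gs x z₀ gs-z₀ gs-other) ⟩
      x * Π gs     ≡⟨ cong (x *_) Πgs≡1 ⟩
      x * 1#       ≡⟨ *-identityʳ x ⟩
      x            ∎
    where
    open Scaling x x∈ x≢0
    νs gs : Fin q → K
    νs i = ν (elt i)
    gs i = ν-factor x (elt i)
    z₀ : Fin q
    z₀ = index 0# Fq-0
    gs-z₀ : gs z₀ ≡ 1#
    gs-z₀ with elt z₀ ≟ 0#
    ... | yes _ = refl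
    ... | no ≢0 = ⊥-elim (≢0 (elt-index 0# Fq-0))
    gs-other : ∀ i → i ≢ z₀ → gs i ≡ x
    gs-other i i≢z₀ with elt i ≟ 0#
    ... | yes ≡0 = ⊥-elim (i≢z₀ (trans (sym (index-elt i (elt-Fq i))) (index-cong _ _ ≡0)))
    ... | no _ = refl
    Πνs≡ : Π νs ≡ Π gs * Π νs
    Πνs≡ = begin
      Π νs                        ≡⟨ ΠK.sum-permute νs σ-permutation ⟩
      Π (λ i → ν (elt (σ i)))     ≡⟨ ΠK.sum-cong-≗ (λ i → trans (cong ν (elt-σ i)) (ν-* x (elt i) x≢0)) ⟩
      Π (λ i → gs i * νs i)       ≡⟨ ΠK.∑-distrib-+ gs νs ⟩
      Π gs * Π νs                 ∎
    Πgs≡1 : Π gs ≡ 1#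
    Πgs≡1 = *-cancelˡ (Π-nonzero νs (λ i → ν-nonzero (elt i)))
      (trans (*-comm (Π νs) (Π gs)) (trans (sym Πνs≡) (sym (*-identityʳ (Π νs)))))

  horner : ∀ {N} → (Fin N → K) → K → K
  horner {zero} c s = 0#
  horner {suc N} c s = c zero + s * horner (λ i → c (suc i)) s

  ∑-horner : ∀ {N} (c : Fin N → K) s → ∑ (λ k → c k * s ^ toℕ k) ≡ horner c s
  ∑-horner {zero} c s = refl
  ∑-horner {suc N} c s = cong₂ _+_ (*-identityʳ (c zero)) (begin
    ∑ (λ k → c (suc k) * (s * s ^ toℕ k)) ≡⟨ ∑-cong (λ k → solve 3 (λ a b c → a :* (b :* c) := b :* (a :* c))
                                                                refl (c (suc k)) s (s ^ toℕ k)) ⟩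
    ∑ (λ k → s * (c (suc k) * s ^ toℕ k)) ≡⟨ sym (∑-*ˡ s (λ k → c (suc k) * s ^ toℕ k)) ⟩
    s * ∑ (λ k → c (suc k) * s ^ toℕ k)   ≡⟨ cong (s *_) (∑-horner (λ k → c (suc k)) s) ⟩
    s * horner (λ i → c (suc i)) s        ∎)

  -- coefficients of the quotient of c(s) by s - a
  quotient : ∀ {N} → (Fin (suc N) → K) → K → Fin N → K
  quotient {suc N} c a zero = horner (λ i → c (suc i)) a
  quotient {suc N} c a (suc k) = quotient (λ i → c (suc i)) a k

  -- division with remainder, c(s) = (s - a) Q(s) + c(a), written without subtraction
  division : ∀ {N} (c : Fin (suc N) → K) a s →
             horner c s + a * horner (quotient c a) s ≡ s * horner (quotient c a) s + horner c a
  division {zero} c a s =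
    solve 3 (λ c₀ s a → c₀ :+ s :* con 0 :+ a :* con 0 := s :* con 0 :+ (c₀ :+ a :* con 0)) refl (c zero) s a
  division {suc N} c a s = begin
    c₀ + s * hs + a * (ha + s * hQ)    ≡⟨ solve 6 (λ c₀ s hs a ha hQ →
                                            c₀ :+ s :* hs :+ a :* (ha :+ s :* hQ) := c₀ :+ a :* ha :+ s :* (hs :+ a :* hQ))
                                            refl c₀ s hs a ha hQ ⟩
    c₀ + a * ha + s * (hs + a * hQ)    ≡⟨ cong (λ z → c₀ + a * ha + s * z) (division C a s) ⟩
    c₀ + a * ha + s * (s * hQ + ha)    ≡⟨ solve 5 (λ c₀ s hQ a ha →
                                            c₀ :+ a :* ha :+ s :* (s :* hQ :+ ha) := s :* (ha :+ s :* hQ) :+ (c₀ :+ a :* ha))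
                                            refl c₀ s hQ a ha ⟩
    s * (ha + s * hQ) + (c₀ + a * ha)  ∎
    where
    C : Fin (suc N) → K
    C i = c (suc i)
    c₀ = c zero
    hs = horner C s
    ha = horner C a
    hQ = horner (quotient C a) s

  quotient-zero : ∀ {N} (c : Fin (suc N) → K) a → (∀ k → quotient c a k ≡ 0#) → horner c a ≡ 0# → ∀ k → c k ≡ 0#
  quotient-zero {zero} c a _ root zero = trans (sym (trans (cong (c zero +_) (zeroʳ a)) (+-identityʳ _))) root
  quotient-zero {suc N} c a Q≡0 root zero =
    trans (sym (trans (cong (λ z → c zero + a * z) (Q≡0 zero)) (trans (cong (c zero +_) (zeroʳ a)) (+-identityʳ _)))) root
  quotient-zero {suc N} c a Q≡0 root (suc k) = quotient-zero (λ i → c (suc i)) a (λ k → Q≡0 (suc k)) (Q≡0 zero) k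

  roots⇒zero : ∀ {N} (c r : Fin N → K) → (∀ {i j} → r i ≡ r j → i ≡ j) → (∀ j → horner c (r j) ≡ 0#) → ∀ k → c k ≡ 0#
  roots⇒zero {suc N} c r r-inj roots = quotient-zero c a Q≡0 (roots zero)
    where
    a = r zero
    Q-root : ∀ j → horner (quotient c a) (r (suc j)) ≡ 0#
    Q-root j = *-cancel-distinct (λ eq → FinP.0≢1+n (sym (r-inj eq))) (begin
      s * hQ                ≡⟨ sym (+-identityʳ _) ⟩
      s * hQ + 0#           ≡⟨ cong (s * hQ +_) (sym (roots zero)) ⟩
      s * hQ + horner c a   ≡⟨ sym (division c a s) ⟩
      horner c s + a * hQ   ≡⟨ cong (_+ a * hQ) (roots (suc j)) ⟩
      0# + a * hQ           ≡⟨ +-identityˡ _ ⟩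
      a * hQ                ∎)
      where
      s = r (suc j)
      hQ = horner (quotient c a) s
    Q≡0 : ∀ k → quotient c a k ≡ 0#
    Q≡0 = roots⇒zero (quotient c a) (λ j → r (suc j)) (λ eq → FinP.suc-injective (r-inj eq)) Q-root

  module SemiringExp = Algebra.Properties.Semiring.Exp semiring
  module SemiringMult = Algebra.Properties.Semiring.Mult semiring
  module MonoidSum = Algebra.Properties.Monoid.Sum +-monoid
  module Binomial = Algebra.Properties.CommutativeSemiring.Binomial commutativeSemiring

  ^≡^ : ∀ x n → x SemiringExp.^ n ≡ x ^ n
  ^≡^ x zero = refl
  ^≡^ x (suc n) = cong (x *_) (^≡^ x n)

  sum≡∑ : ∀ {n} (f : Fin n → K) → MonoidSum.sum f ≡ ∑ f
  sum≡∑ {zero} f = refl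
  sum≡∑ {suc n} f = cong (f zero +_) (sum≡∑ (λ i → f (suc i)))

  ×≡* : ∀ n a → n SemiringMult.× a ≡ (n SemiringMult.× 1#) * a
  ×≡* zero a = sym (zeroˡ a)
  ×≡* (suc n) a = trans (cong₂ _+_ (sym (*-identityˡ a)) (×≡* n a)) (sym (distribʳ a 1# _))

  𝔹 : (N : ℕ) → Fin (suc N) → K
  𝔹 N k = (N choose toℕ k) SemiringMult.× 1#

  binomialTerm : (N : ℕ) → K → K → Fin (suc N) → K
  binomialTerm N x y k = 𝔹 N k * (x ^ toℕ k * y ^ (N ∸ toℕ k))

  binomial-theorem : ∀ N x y → (x + y) ^ N ≡ ∑ (binomialTerm N x y)
  binomial-theorem N x y = begin
    (x + y) ^ N                          ≡⟨ sym (^≡^ (x + y) N) ⟩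
    (x + y) SemiringExp.^ N              ≡⟨ Binomial.theorem N x y ⟩
    Binomial.binomialExpansion x y N     ≡⟨ sum≡∑ (Binomial.binomialTerm x y N) ⟩
    ∑ {suc N} (λ k → (N choose toℕ k) SemiringMult.× (x SemiringExp.^ toℕ k * y SemiringExp.^ (N ∸ toℕ k)))
      ≡⟨ ∑-cong (λ k → trans (×≡* (N choose toℕ k) _)
                         (cong (𝔹 N k *_) (cong₂ _*_ (^≡^ x (toℕ k)) (^≡^ y (N ∸ toℕ k))))) ⟩
    ∑ (binomialTerm N x y)               ∎

  interior : (n : ℕ) → K → K → K
  interior n x y = ∑ (λ k → binomialTerm (suc n) x y (suc (inject₁ k)))

  binomial-ends : ∀ n x y → (x + y) ^ suc n ≡ y ^ suc n + interior n x y + x ^ suc n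
  binomial-ends n x y = begin
    (x + y) ^ N                                            ≡⟨ binomial-theorem N x y ⟩
    ∑ (binomialTerm N x y)                                 ≡⟨ ∑-ends (binomialTerm N x y) ⟩
    binomialTerm N x y zero + interior n x y + binomialTerm N x y (fromℕ N)
      ≡⟨ cong₂ (λ a b → a + interior n x y + b) first-term last-term ⟩
    y ^ N + interior n x y + x ^ N                         ∎
    where
    N = suc n
    first-term : binomialTerm N x y zero ≡ y ^ N
    first-term = trans (cong₂ _*_ (+-identityʳ 1#) (*-identityˡ _)) (*-identityˡ _)
    last-coefficient : 𝔹 N (fromℕ N) ≡ 1#
    last-coefficient = trans (cong (λ m → (N choose m) SemiringMult.× 1#) (FinP.toℕ-fromℕ N))
                             (trans (cong (SemiringMult._× 1#) (nCn≡1 N)) (+-identityʳ 1#))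
    last-term : binomialTerm N x y (fromℕ N) ≡ x ^ N
    last-term = trans (cong₂ _*_ last-coefficient
                        (cong₂ (λ a b → x ^ a * y ^ b) (FinP.toℕ-fromℕ N)
                               (trans (cong (N ∸_) (FinP.toℕ-fromℕ N)) (ℕP.n∸n≡0 N))))
                      (trans (*-identityˡ _) (*-identityʳ _))

  -- If N = n + 1 distinct elements s satisfy s^N = s and (s + 1)^N = s + 1,
  -- the interior binomial coefficients of N vanish in K: by the binomial
  -- theorem, the polynomial Σ_{0<k<N} 𝔹_k s^k (N coefficients) has the N roots r j.
  interior-binomial-vanishes : ∀ {n} (r : Fin (suc n) → K) → (∀ {i j} → r i ≡ r j → i ≡ j) →
    (∀ j → r j ^ suc n ≡ r j) → (∀ j → (r j + 1#) ^ suc n ≡ r j + 1#) →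
    ∀ k → 𝔹 (suc n) (suc (inject₁ k)) ≡ 0#
  interior-binomial-vanishes {n} r r-inj fix fix+1 k = roots⇒zero c r r-inj c-roots (suc k)
    where
    N = suc n
    c : Fin N → K
    c zero = 0#
    c (suc k) = 𝔹 N (suc (inject₁ k))
    interior-horner : ∀ s → interior n s 1# ≡ horner c s
    interior-horner s = begin
      interior n s 1#                         ≡⟨ ∑-cong term ⟩
      ∑ (λ k → s * (c (suc k) * s ^ toℕ k))   ≡⟨ sym (∑-*ˡ s (λ k → c (suc k) * s ^ toℕ k)) ⟩
      s * ∑ (λ k → c (suc k) * s ^ toℕ k)     ≡⟨ cong (s *_) (∑-horner (λ k → c (suc k)) s) ⟩
      s * horner (λ k → c (suc k)) s          ≡⟨ sym (+-identityˡ _) ⟩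
      horner c s                              ∎
      where
      term : ∀ k → binomialTerm N s 1# (suc (inject₁ k)) ≡ s * (c (suc k) * s ^ toℕ k)
      term k = begin
        c (suc k) * (s * s ^ toℕ (inject₁ k) * 1# ^ (n ∸ toℕ (inject₁ k)))
          ≡⟨ cong₂ (λ e o → c (suc k) * (s * s ^ e * o)) (FinP.toℕ-inject₁ k) (1^ (n ∸ toℕ (inject₁ k))) ⟩
        c (suc k) * (s * s ^ toℕ k * 1#)
          ≡⟨ solve 3 (λ b s p → b :* (s :* p :* con 1) := s :* (b :* p)) refl (c (suc k)) s (s ^ toℕ k) ⟩
        s * (c (suc k) * s ^ toℕ k)   ∎
    c-roots : ∀ j → horner c (r j) ≡ 0#
    c-roots j = trans (sym (interior-horner s)) (RP.+-cancelˡ 1# _ _ (RP.+-cancelʳ s _ _ (begin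
      1# + interior n s 1# + s              ≡⟨ cong₂ (λ a b → a + interior n s 1# + b) (sym (1^ N)) (sym (fix j)) ⟩
      1# ^ N + interior n s 1# + s ^ N      ≡⟨ sym (binomial-ends n s 1#) ⟩
      (s + 1#) ^ N                          ≡⟨ fix+1 j ⟩
      s + 1#                                ≡⟨ +-comm s 1# ⟩
      1# + s                                ≡⟨ cong (_+ s) (sym (+-identityʳ 1#)) ⟩
      1# + 0# + s                           ∎)))
      where s = r j

  frobenius-criterion : ∀ {N} → 1 ≤ N → (r : Fin N → K) → (∀ {i j} → r i ≡ r j → i ≡ j) →
    (∀ j → r j ^ N ≡ r j) → (∀ j → (r j + 1#) ^ N ≡ r j + 1#) → ∀ x y → (x + y) ^ N ≡ x ^ N + y ^ N
  frobenius-criterion {suc n} (s≤s z≤n) r r-inj fix fix+1 x y = begin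
    (x + y) ^ N                         ≡⟨ binomial-ends n x y ⟩
    y ^ N + interior n x y + x ^ N      ≡⟨ cong (λ m → y ^ N + m + x ^ N) interior≡0 ⟩
    y ^ N + 0# + x ^ N                  ≡⟨ cong (_+ x ^ N) (+-identityʳ _) ⟩
    y ^ N + x ^ N                       ≡⟨ +-comm _ _ ⟩
    x ^ N + y ^ N                       ∎
    where
    N = suc n
    interior≡0 : interior n x y ≡ 0#
    interior≡0 = trans (∑-cong (λ k → trans (cong (_* monomial k) (interior-binomial-vanishes r r-inj fix fix+1 k))
                                            (zeroˡ (monomial k))))
                       (∑-zero n)
      where
      monomial : Fin n → K
      monomial k = x ^ toℕ (suc (inject₁ k)) * y ^ (N ∸ toℕ (suc (inject₁ k)))

  frobenius : ∀ x y → (x + y) ^ q ≡ x ^ q + y ^ q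
  frobenius = frobenius-criterion 1≤q elt elt-injective
    (λ j → fermat (elt j) (elt-Fq j)) (λ j → fermat _ (Fq-+ _ _ (elt-Fq j) Fq-1))

  frobenius-linear : ∀ {α β} u v → InFq α → InFq β → (α * u + β * v) ^ q ≡ α * u ^ q + β * v ^ q
  frobenius-linear {α} {β} u v α∈ β∈ = trans (frobenius (α * u) (β * v))
    (cong₂ _+_ (trans (*-^ α u q) (cong (_* u ^ q) (fermat α α∈)))
               (trans (*-^ β v q) (cong (_* v ^ q) (fermat β β∈))))

  -- The binary form Σ_{k ≤ n} α^(n-k) β^k w_k with vector coefficients w.
  form : (n : ℕ) → (Fin (suc n) → K) → K → K → K
  form zero w α β = w zero
  form (suc n) w α β = α ^ suc n * w zero + β * form n (λ i → w (suc i)) α β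

  -- coefficients of (αu + βv) · form n w α β: the k-th is u w_k + v w_{k-1}
  linearTimes : K → K → ∀ {n} → (Fin (suc n) → K) → Fin (suc (suc n)) → K
  linearTimes u v {zero} w zero = u * w zero
  linearTimes u v {zero} w (suc zero) = v * w zero
  linearTimes u v {suc n} w zero = u * w zero
  linearTimes u v {suc n} w (suc zero) = v * w zero + linearTimes u v (λ i → w (suc i)) zero
  linearTimes u v {suc n} w (suc (suc k)) = linearTimes u v (λ i → w (suc i)) (suc k)

  linearTimes-form : ∀ u v n (w : Fin (suc n) → K) α β →
                     (α * u + β * v) * form n w α β ≡ form (suc n) (linearTimes u v w) α β
  linearTimes-form u v zero w α β = begin
    (α * u + β * v) * w zero                 ≡⟨ solve 5 (λ α u β v w →
                                                      (α :* u :+ β :* v) :* w := α :* con 1 :* (u :* w) :+ β :* (v :* w))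
                                                      refl α u β v (w zero) ⟩
    α * 1# * (u * w zero) + β * (v * w zero) ∎
  linearTimes-form u v (suc m) w α β = begin
    L * (A * w₀ + β * X)                                        ≡⟨ solve 7 (λ α u β v A w₀ X →
        (α :* u :+ β :* v) :* (A :* w₀ :+ β :* X)
          := α :* A :* (u :* w₀) :+ β :* (A :* (v :* w₀)) :+ β :* ((α :* u :+ β :* v) :* X)) refl α u β v A w₀ X ⟩
    α * A * (u * w₀) + β * (A * (v * w₀)) + β * (L * X)         ≡⟨ cong (λ z → α * A * (u * w₀) + β * (A * (v * w₀)) + β * z)
                                                                     (linearTimes-form u v m w' α β) ⟩
    α * A * (u * w₀) + β * (A * (v * w₀)) + β * (A * m₀ + β * Y) ≡⟨ solve 8 (λ α A u w₀ β v m₀ Y →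
        α :* A :* (u :* w₀) :+ β :* (A :* (v :* w₀)) :+ β :* (A :* m₀ :+ β :* Y)
          := α :* A :* (u :* w₀) :+ β :* (A :* (v :* w₀ :+ m₀) :+ β :* Y)) refl α A u w₀ β v m₀ Y ⟩
    α * A * (u * w₀) + β * (A * (v * w₀ + m₀) + β * Y)           ∎
    where
    L = α * u + β * v
    w' : Fin (suc m) → K
    w' i = w (suc i)
    A = α ^ suc m
    w₀ = w zero
    X = form m w' α β
    m₀ = linearTimes u v w' zero
    Y = form m (λ i → linearTimes u v w' (suc i)) α β

  linearPowTimes : K → K → (a : ℕ) → ∀ {m} → (Fin (suc m) → K) → Fin (suc (a ℕ.+ m)) → K
  linearPowTimes u v zero w = w
  linearPowTimes u v (suc a) w = linearTimes u v (linearPowTimes u v a w)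

  linearPowTimes-form : ∀ u v a m (w : Fin (suc m) → K) α β →
    (α * u + β * v) ^ a * form m w α β ≡ form (a ℕ.+ m) (linearPowTimes u v a w) α β
  linearPowTimes-form u v zero m w α β = *-identityˡ _
  linearPowTimes-form u v (suc a) m w α β = begin
    L * L ^ a * form m w α β                            ≡⟨ *-assoc L (L ^ a) _ ⟩
    L * (L ^ a * form m w α β)                          ≡⟨ cong (L *_) (linearPowTimes-form u v a m w α β) ⟩
    L * form (a ℕ.+ m) (linearPowTimes u v a w) α β     ≡⟨ linearTimes-form u v (a ℕ.+ m) _ α β ⟩
    form (suc a ℕ.+ m) (linearPowTimes u v (suc a) w) α β ∎
    where L = α * u + β * v

  form-scale : ∀ n (w : Fin (suc n) → K) γ α β → form n w (γ * α) (γ * β) ≡ γ ^ n * form n w α β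
  form-scale zero w γ α β = sym (*-identityˡ _)
  form-scale (suc n) w γ α β = begin
    (γ * α) ^ suc n * w zero + γ * β * form n w' (γ * α) (γ * β)
      ≡⟨ cong₂ (λ a b → a * w zero + γ * β * b) (*-^ γ α (suc n)) (form-scale n w' γ α β) ⟩
    γ ^ suc n * α ^ suc n * w zero + γ * β * (γ ^ n * form n w' α β)
      ≡⟨ solve 6 (λ g gn an w₀ b H → g :* gn :* an :* w₀ :+ g :* b :* (gn :* H) := g :* gn :* (an :* w₀ :+ b :* H))
           refl γ (γ ^ n) (α ^ suc n) (w zero) β (form n w' α β) ⟩
    γ ^ suc n * (α ^ suc n * w zero + β * form n w' α β) ∎
    where
    w' : Fin (suc n) → K
    w' i = w (suc i)

  form-affine : ∀ n (w : Fin (suc n) → K) l → form n w 1# l ≡ ∑ (λ i → (l ^ toℕ i) * w i)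
  form-affine zero w l = sym (trans (+-identityʳ _) (*-identityˡ _))
  form-affine (suc n) w l = cong₂ _+_ (cong (_* w zero) (1^ (suc n))) (begin
    l * form n (λ i → w (suc i)) 1# l           ≡⟨ cong (l *_) (form-affine n (λ i → w (suc i)) l) ⟩
    l * ∑ (λ i → l ^ toℕ i * w (suc i))         ≡⟨ ∑-*ˡ l (λ i → l ^ toℕ i * w (suc i)) ⟩
    ∑ (λ i → l * (l ^ toℕ i * w (suc i)))       ≡⟨ ∑-cong (λ i → sym (*-assoc l (l ^ toℕ i) (w (suc i)))) ⟩
    ∑ (λ i → l * l ^ toℕ i * w (suc i))         ∎)

  form-infinity : ∀ n (w : Fin (suc n) → K) → form n w 0# 1# ≡ w (fromℕ n)
  form-infinity zero w = refl
  form-infinity (suc n) w = begin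
    0# ^ suc n * w zero + 1# * form n (λ i → w (suc i)) 0# 1#
      ≡⟨ cong₂ _+_ (trans (cong (_* w zero) (zeroˡ _)) (zeroˡ _)) (*-identityˡ _) ⟩
    0# + form n (λ i → w (suc i)) 0# 1#   ≡⟨ +-identityˡ _ ⟩
    form n (λ i → w (suc i)) 0# 1#        ≡⟨ form-infinity n (λ i → w (suc i)) ⟩
    w (fromℕ (suc n))                     ∎

  monomials : (n : ℕ) → K → K → Fin (suc n) → K
  monomials zero α β zero = 1#
  monomials (suc n) α β zero = α ^ suc n
  monomials (suc n) α β (suc k) = β * monomials n α β k

  monomials-Fq : ∀ n {α β} → InFq α → InFq β → FqValued (monomials n α β)
  monomials-Fq zero α∈ β∈ zero = Fq-1
  monomials-Fq (suc n) α∈ β∈ zero = ^-Fq (suc n) α∈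
  monomials-Fq (suc n) α∈ β∈ (suc k) = Fq-* _ _ β∈ (monomials-Fq n α∈ β∈ k)

  form-comb : ∀ n (w : Fin (suc n) → K) α β → form n w α β ≡ comb (monomials n α β) w
  form-comb zero w α β = sym (trans (+-identityʳ _) (*-identityˡ _))
  form-comb (suc n) w α β = cong (α ^ suc n * w zero +_) (begin
    β * form n (λ i → w (suc i)) α β                  ≡⟨ cong (β *_) (form-comb n (λ i → w (suc i)) α β) ⟩
    β * ∑ (λ i → monomials n α β i * w (suc i))       ≡⟨ ∑-*ˡ β (λ i → monomials n α β i * w (suc i)) ⟩
    ∑ (λ i → β * (monomials n α β i * w (suc i)))     ≡⟨ ∑-cong (λ i → sym (*-assoc β (monomials n α β i) (w (suc i)))) ⟩
    ∑ (λ i → β * monomials n α β i * w (suc i))       ∎)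

  -- The vectors w₀,…,w_n of the curve: the coefficients of
  -- Πᵢ (α u^(qⁱ) + β v^(qⁱ))^(aᵢ) for the digits a₀, a₁, … of d.
  curveBasis : K → K → (as : List ℕ) → Fin (suc (sum as)) → K
  curveBasis u v [] = λ _ → 1#
  curveBasis u v (a ∷ as) = linearPowTimes u v a (curveBasis (u ^ q) (v ^ q) as)

  -- (αu + βv)^d = form d_q (curveBasis u v) α β, for α, β ∈ F_q and d = Σ aᵢ qⁱ:
  -- split off the lowest digit and use that (αu + βv)^q = α u^q + β v^q.
  power-as-form : ∀ as u v {α β} → InFq α → InFq β →
                  (α * u + β * v) ^ fromDigits q as ≡ form (sum as) (curveBasis u v as) α β
  power-as-form [] u v α∈ β∈ = refl
  power-as-form (a ∷ as) u v {α} {β} α∈ β∈ = begin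
    L ^ (a ℕ.+ q ℕ.* D)                                 ≡⟨ ^-+ L a (q ℕ.* D) ⟩
    L ^ a * L ^ (q ℕ.* D)                               ≡⟨ cong (L ^ a *_) (^-* L q D) ⟩
    L ^ a * (L ^ q) ^ D                                 ≡⟨ cong (λ z → L ^ a * z ^ D) (frobenius-linear u v α∈ β∈) ⟩
    L ^ a * (α * u ^ q + β * v ^ q) ^ D                 ≡⟨ cong (L ^ a *_) (power-as-form as (u ^ q) (v ^ q) α∈ β∈) ⟩
    L ^ a * form (sum as) (curveBasis (u ^ q) (v ^ q) as) α β ≡⟨ linearPowTimes-form u v a (sum as) _ α β ⟩
    form (a ℕ.+ sum as) (curveBasis u v (a ∷ as)) α β   ∎
    where
    L = α * u + β * v
    D = fromDigits q as

  -- F_q-valued vectors of length N, coded as elements of Fin (q ^ N).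
  decode : ∀ {N} → Fin (q ℕ.^ N) → Fin N → K
  decode {N} x i = elt (finToFun {q} {N} x i)

  encode : ∀ {N} (c : Fin N → K) → FqValued c → Fin (q ℕ.^ N)
  encode c c∈ = funToFin (λ i → index (c i) (c∈ i))

  decode-Fq : ∀ {N} (x : Fin (q ℕ.^ N)) → FqValued (decode x)
  decode-Fq {N} x i = elt-Fq (finToFun {q} {N} x i)

  decode-encode : ∀ {N} (c : Fin N → K) c∈ i → decode (encode c c∈) i ≡ c i
  decode-encode c c∈ i = trans (cong elt (FinP.finToFun-funToFin (λ i → index (c i) (c∈ i)) i)) (elt-index (c i) (c∈ i))

  funToFin-cong : ∀ {m n} {f g : Fin m → Fin n} → (∀ i → f i ≡ g i) → funToFin f ≡ funToFin g
  funToFin-cong {zero} _ = refl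
  funToFin-cong {suc m} f≗g = cong₂ Fin.combine (f≗g zero) (funToFin-cong (λ i → f≗g (suc i)))

  decode-injective : ∀ {N} {x x' : Fin (q ℕ.^ N)} → (∀ i → decode {N} x i ≡ decode {N} x' i) → x ≡ x'
  decode-injective {N} {x} {x'} eq = begin
    x                      ≡⟨ sym (FinP.funToFin-finToFin {m = N} {n = q} x) ⟩
    funToFin (finToFun {q} {N} x)  ≡⟨ funToFin-cong (λ i → elt-injective (eq i)) ⟩
    funToFin (finToFun {q} {N} x') ≡⟨ FinP.funToFin-finToFin {m = N} {n = q} x' ⟩
    x'                     ∎

  injective⇒surjective : ∀ {m} (f : Fin m → Fin m) → (∀ {x y} → f x ≡ f y → x ≡ y) →
                         ∀ y → Σ (Fin m) λ x → f x ≡ y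
  injective⇒surjective {suc m} f f-inj y with FinP.any? (λ x → f x Fin.≟ y)
  ... | yes hit = hit
  ... | no miss with FinP.pigeonhole (ℕP.n<1+n m) (λ x → Fin.punchOut {i = y} (λ eq → miss (x , sym eq)))
  ... | i , j , i<j , eq = ⊥-elim (FinP.<-irrefl
          (f-inj (FinP.punchOut-injective {i = y} (λ e → miss (i , sym e)) (λ e → miss (j , sym e)) eq)) i<j)

  Fq-injective⇒surjective : ∀ {N} (φ : (Fin N → K) → Fin N → K) → (∀ c → FqValued c → FqValued (φ c)) →
    (∀ {c c'} → FqValued c → FqValued c' → (∀ j → φ c j ≡ φ c' j) → ∀ i → c i ≡ c' i) →
    ∀ c → FqValued c → Σ (Fin N → K) λ c' → FqValued c' × (∀ j → φ c' j ≡ c j)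
  Fq-injective⇒surjective {N} φ φ-Fq φ-inj c c∈ = decode {N} x , decode-Fq {N} x , φ-hit
    where
    Φ : Fin (q ℕ.^ N) → Fin (q ℕ.^ N)
    Φ x = encode (φ (decode x)) (φ-Fq _ (decode-Fq {N} x))
    decode-Φ : ∀ x j → decode (Φ x) j ≡ φ (decode x) j
    decode-Φ x = decode-encode (φ (decode x)) (φ-Fq _ (decode-Fq {N} x))
    Φ-inj : ∀ {x x'} → Φ x ≡ Φ x' → x ≡ x'
    Φ-inj {x} {x'} eq = decode-injective {N} (φ-inj (decode-Fq {N} x) (decode-Fq {N} x')
      (λ j → trans (sym (decode-Φ x j)) (trans (cong (λ y → decode y j) eq) (decode-Φ x' j))))
    x = proj₁ (injective⇒surjective Φ Φ-inj (encode c c∈))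
    φ-hit : ∀ j → φ (decode {N} x) j ≡ c j
    φ-hit j = trans (sym (decode-Φ x j))
      (trans (cong (λ y → decode y j) (proj₂ (injective⇒surjective Φ Φ-inj (encode c c∈)))) (decode-encode c c∈ j))

  -- Exchange lemma: if N independent vectors p lie in the span of N vectors w,
  -- then w is independent and spans the same subspace as p.  The coordinate
  -- change c ↦ φ c, with Σ cᵢ pᵢ = Σ (φ c)_j w_j, is injective by independence
  -- of p, hence surjective.
  module Exchange {N} (p w : Fin N → K) (p∈⟨w⟩ : ∀ i → InSpan w (p i)) (p-indep : Indep p) where
    C : Fin N → Fin N → K
    C i = proj₁ (p∈⟨w⟩ i)

    φ : (Fin N → K) → Fin N → K
    φ c j = ∑ (λ i → c i * C i j)

    φ-Fq : ∀ c → FqValued c → FqValued (φ c)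
    φ-Fq c c∈ j = ∑-Fq _ (λ i → Fq-* _ _ (c∈ i) (proj₁ (proj₂ (p∈⟨w⟩ i)) j))

    comb-φ : ∀ c → comb c p ≡ comb (φ c) w
    comb-φ c = begin
      ∑ (λ i → c i * p i)                            ≡⟨ ∑-cong (λ i → cong (c i *_) (proj₂ (proj₂ (p∈⟨w⟩ i)))) ⟩
      ∑ (λ i → c i * ∑ (λ j → C i j * w j))          ≡⟨ ∑-cong (λ i → ∑-*ˡ (c i) (λ j → C i j * w j)) ⟩
      ∑ (λ i → ∑ (λ j → c i * (C i j * w j)))        ≡⟨ ∑-swap (λ i j → c i * (C i j * w j)) ⟩
      ∑ (λ j → ∑ (λ i → c i * (C i j * w j)))        ≡⟨ ∑-cong (λ j → ∑-cong (λ i → sym (*-assoc (c i) (C i j) (w j)))) ⟩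
      ∑ (λ j → ∑ (λ i → c i * C i j * w j))          ≡⟨ ∑-cong (λ j → sym (φ-times j)) ⟩
      ∑ (λ j → φ c j * w j)                          ∎
      where
      φ-times : ∀ j → φ c j * w j ≡ ∑ (λ i → c i * C i j * w j)
      φ-times j = trans (*-comm (φ c j) (w j))
        (trans (∑-*ˡ (w j) (λ i → c i * C i j)) (∑-cong (λ i → *-comm (w j) (c i * C i j))))

    φ-injective : ∀ {c c'} → FqValued c → FqValued c' → (∀ j → φ c j ≡ φ c' j) → ∀ i → c i ≡ c' i
    φ-injective {c} {c'} c∈ c'∈ φc≗φc' = indep-coefficients p-indep c∈ c'∈
      (trans (comb-φ c) (trans (comb-cong w φc≗φc') (sym (comb-φ c'))))

    φ-surjective : ∀ c → FqValued c → Σ (Fin N → K) λ c' → FqValued c' × (∀ j → φ c' j ≡ c j)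
    φ-surjective = Fq-injective⇒surjective φ φ-Fq φ-injective

    span⟨p⟩⊆span⟨w⟩ : ∀ x → InSpan p x → InSpan w x
    span⟨p⟩⊆span⟨w⟩ x (c , c∈ , x≡) = φ c , φ-Fq c c∈ , trans x≡ (comb-φ c)

    span⟨w⟩⊆span⟨p⟩ : ∀ x → InSpan w x → InSpan p x
    span⟨w⟩⊆span⟨p⟩ x (c , c∈ , x≡) with φ-surjective c c∈
    ... | c' , c'∈ , φc'≗c = c' , c'∈ , trans x≡ (trans (comb-cong w (λ j → sym (φc'≗c j))) (sym (comb-φ c')))

    w-indep : Indep w
    w-indep c c∈ comb≡0 j with φ-surjective c c∈
    ... | c' , c'∈ , φc'≗c = begin
      c j                       ≡⟨ sym (φc'≗c j) ⟩
      ∑ (λ i → c' i * C i j)    ≡⟨ ∑-cong (λ i → trans (cong (_* C i j) (c'≡0 i)) (zeroˡ (C i j))) ⟩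
      ∑ {N} (λ _ → 0#)          ≡⟨ ∑-zero N ⟩
      0#                        ∎
      where
      c'≡0 : ∀ i → c' i ≡ 0#
      c'≡0 = p-indep c' c'∈ (trans (comb-φ c') (trans (comb-cong w φc'≗c) comb≡0))

  comb-pair : ∀ (c : Fin 2 → K) u v → comb c (pair u v) ≡ c zero * u + c (suc zero) * v
  comb-pair c u v = cong (c zero * u +_) (+-identityʳ _)

  module Curve (u v : K) (ℓ-indep : Indep (pair u v)) (as : List ℕ) where
    n d : ℕ
    n = sum as
    d = fromDigits q as

    w : Fin (suc n) → K
    w = curveBasis u v as

    onLine : ∀ {α β} → InFq α → InFq β → (α ≢ 0# ⊎ β ≢ 0#) → OnLine u v (α * u + β * v)
    onLine {α} {β} α∈ β∈ nonzero = x≢0 , pair α β , c∈ , sym (comb-pair (pair α β) u v)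
      where
      c∈ : FqValued (pair α β)
      c∈ zero = α∈
      c∈ (suc _) = β∈
      x≢0 : α * u + β * v ≢ 0#
      x≢0 x≡0 = [ (λ α≢0 → α≢0 (αβ≡0 zero)) , (λ β≢0 → β≢0 (αβ≡0 (suc zero))) ] nonzero
        where αβ≡0 = ℓ-indep (pair α β) c∈ (trans (comb-pair (pair α β) u v) x≡0)

    record FormRep (y : K) : Set where
      field
        μ α β : K
        μ∈ : InFq μ
        α∈ : InFq α
        β∈ : InFq β
        μ≢0 : μ ≢ 0#
        x≢0 : α * u + β * v ≢ 0#
        y≡ : y ≡ μ * form n w α β

    formRep : ∀ {y} → OnLinePow d u v y → FormRep y
    formRep (_ , x , (x≢0 , c , c∈ , x≡) , (μ , μ∈ , μ≢0 , y≡)) = record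
      { μ = μ ; α = c zero ; β = c (suc zero) ; μ∈ = μ∈ ; α∈ = c∈ zero ; β∈ = c∈ (suc zero) ; μ≢0 = μ≢0
      ; x≢0 = λ eq → x≢0 (trans x≡′ eq)
      ; y≡ = trans y≡ (cong (μ *_) (trans (cong (_^ d) x≡′) (power-as-form as u v (c∈ zero) (c∈ (suc zero))))) }
      where
      x≡′ : x ≡ c zero * u + c (suc zero) * v
      x≡′ = trans x≡ (comb-pair c u v)

    samePoint-form : ∀ {y μ γ α β} → InFq μ → μ ≢ 0# → InFq γ → γ ≢ 0# →
                     y ≡ μ * form n w (γ * α) (γ * β) → SamePoint y (form n w α β)
    samePoint-form {y} {μ} {γ} μ∈ μ≢0 γ∈ γ≢0 y≡ =
      μ * γ ^ n , Fq-* _ _ μ∈ (^-Fq n γ∈) , *-nonzero μ≢0 (^-nonzero n γ≢0) ,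
      trans y≡ (trans (cong (μ *_) (form-scale n w γ _ _)) (sym (*-assoc μ (γ ^ n) _)))

    -- Every point of ℓ^d is on the curve: an affine point with l = β/α if
    -- α ≠ 0, and the point ⟨w_n⟩ if α = 0.
    ℓ^d⊆curve : ∀ y → OnLinePow d u v y → NRCPoint n w y
    ℓ^d⊆curve y y∈ = proj₁ y∈ , onCurve (α ≟ 0#)
      where
      open FormRep (formRep y∈)
      onCurve : Dec (α ≡ 0#) →
        (Σ K λ l → InFq l × SamePoint y (∑ (λ i → (l ^ toℕ i) * w i))) ⊎ SamePoint y (w (fromℕ n))
      onCurve (no α≢0) = inj₁ (l , Fq-* _ _ β∈ (Fq-inv α α≢0 α∈) ,
        subst (SamePoint y) (form-affine n w l)
          (samePoint-form μ∈ μ≢0 α∈ α≢0 (trans y≡ (cong (μ *_) (cong₂ (form n w) (sym (*-identityʳ α)) (sym αl≡β))))))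
        where
        l = β * inv α
        αl≡β : α * l ≡ β
        αl≡β = trans (cong (α *_) (*-comm β (inv α))) (*-inv-cancel α≢0 β)
      onCurve (yes α≡0) = inj₂ (subst (SamePoint y) (form-infinity n w)
        (samePoint-form μ∈ μ≢0 β∈ β≢0
          (trans y≡ (cong (μ *_) (cong₂ (form n w) (trans α≡0 (sym (zeroʳ β))) (sym (*-identityʳ β)))))))
        where
        β≢0 : β ≢ 0#
        β≢0 β≡0 = x≢0 (trans (cong₂ (λ a b → a * u + b * v) α≡0 β≡0)
                             (trans (cong₂ _+_ (zeroˡ u) (zeroˡ v)) (+-identityʳ 0#)))

    -- Every point of the curve is in ℓ^d: it is ⟨(u + l v)^d⟩ or ⟨v^d⟩.
    curve⊆ℓ^d : ∀ y → NRCPoint n w y → OnLinePow d u v y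
    curve⊆ℓ^d y (y≢0 , inj₁ (l , l∈ , μ , μ∈ , μ≢0 , y≡)) =
      y≢0 , 1# * u + l * v , onLine Fq-1 l∈ (inj₁ 1≢0) , μ , μ∈ , μ≢0 ,
      trans y≡ (cong (μ *_) (trans (sym (form-affine n w l)) (sym (power-as-form as u v Fq-1 l∈))))
    curve⊆ℓ^d y (y≢0 , inj₂ (μ , μ∈ , μ≢0 , y≡)) =
      y≢0 , 0# * u + 1# * v , onLine Fq-0 Fq-1 (inj₂ 1≢0) , μ , μ∈ , μ≢0 ,
      trans y≡ (cong (μ *_) (trans (sym (form-infinity n w)) (sym (power-as-form as u v Fq-0 Fq-1))))

    ℓ^d⊆span⟨w⟩ : ∀ {y} → OnLinePow d u v y → InSpan w y
    ℓ^d⊆span⟨w⟩ y∈ = (λ k → μ * monomials n α β k) , (λ k → Fq-* _ _ μ∈ (monomials-Fq n α∈ β∈ k)) ,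
      trans y≡ (trans (cong (μ *_) (form-comb n w α β)) (comb-*ˡ μ (monomials n α β) w))
      where open FormRep (formRep y∈)

lemma5p9 : {q t : ℕ} (F : FieldExt q t) →
    let open FieldExt F in let open Geometry F in
    (u v : K) → Indep (pair u v) →
    (d : ℕ) (as : List ℕ) → All (λ a → a < q) as → d ≡ fromDigits q as →
    sum as ≤ q →
    (p : Fin (suc (sum as)) → K) → (∀ i → OnLinePow d u v (p i)) → Indep p →
    IsNRC (sum as) (InSpan p) (OnLinePow d u v)
lemma5p9 {q} F u v ℓ-indep .(fromDigits q as) as _ refl _ p p∈ℓ^d p-indep =
  w , w-indep ,
  (λ x → mk⇔ (span⟨w⟩⊆span⟨p⟩ x) (span⟨p⟩⊆span⟨w⟩ x)) ,
  (λ y → mk⇔ (ℓ^d⊆curve y) (curve⊆ℓ^d y))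
  where
  open Curve F u v ℓ-indep as
  open Exchange F p w (λ i → ℓ^d⊆span⟨w⟩ (p∈ℓ^d i)) p-indep
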